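{- If $T$ is a tree, then ${\rm gpack}(T)={\rm gt}(T)$.
   Context: A geodesic in a graph $G$ is a shortest path between its end-vertices; it is maximal if it is not contained as a subpath in any other geodesic of $G$. A geodesic packing of $G$ is a set of pairwise vertex-disjoint maximal geodesics of $G$, and ${\rm gpack}(G)$ is the maximum cardinality of a geodesic packing of $G$. A set $S\subseteq V(G)$ is a geodesic transversal of $G$ if every maximal geodesic of $G$ contains at least one vertex of $S$, and ${\rm gt}(G)$ is the minimum cardinality of a geodesic transversal of $G$. -}

module Defs where

open import Data.Nat using (ℕ; _≤_; _<_)
open import Data.Fin using (Fin)
open import Data.Fin.Subset using (Subset; _∈_; ∣_∣)
open import Data.Bool using (Bool; true)
open import Data.List using (List; []; _∷_; _++_; [_]; length; reverse; head; last)
open import Data.List.Relation.Unary.Linked using (Linked)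
open import Data.List.Relation.Unary.Any using (Any)
open import Data.List.Relation.Unary.AllPairs using (AllPairs)
open import Data.List.Relation.Unary.All using (All)
open import Data.List.Relation.Unary.Unique.Propositional using (Unique)
open import Data.List.Relation.Binary.Infix.Heterogeneous using (Infix)
import Data.List.Membership.Propositional as LM
open import Data.Maybe using (just)
open import Data.Product using (Σ; _×_; ∃)
open import Data.Sum using (_⊎_)
open import Data.Empty using (⊥)
open import Relation.Nullary using (¬_)
open import Relation.Binary.PropositionalEquality using (_≡_; _≢_)

record Graph (n : ℕ) : Set where
  field
    adj    : Fin n → Fin n → Bool
    sym    : ∀ u v → adj u v ≡ adj v u
    irrefl : ∀ u → adj u u ≡ true → ⊥

module _ {n : ℕ} (G : Graph n) where
  open Graph G

  Edge : Fin n → Fin n → Set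
  Edge u v = adj u v ≡ true

  IsWalk : List (Fin n) → Set
  IsWalk P = (P ≢ []) × Linked Edge P

  IsGeodesic : List (Fin n) → Set
  IsGeodesic P = IsWalk P ×
    (∀ Q → IsWalk Q → head Q ≡ head P → last Q ≡ last P → length P ≤ length Q)

  ProperSubpath : List (Fin n) → List (Fin n) → Set
  ProperSubpath P Q = (Infix _≡_ P Q ⊎ Infix _≡_ (reverse P) Q) × length P < length Q

  IsMaxGeodesic : List (Fin n) → Set
  IsMaxGeodesic P = IsGeodesic P × (¬ (∃ λ Q → IsGeodesic Q × ProperSubpath P Q))

  VertexDisjoint : List (Fin n) → List (Fin n) → Set
  VertexDisjoint P Q = ∀ x → x LM.∈ P → x LM.∈ Q → ⊥

  IsGeodesicPacking : List (List (Fin n)) → Set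
  IsGeodesicPacking Ps = All IsMaxGeodesic Ps × AllPairs VertexDisjoint Ps

  IsGpack : ℕ → Set
  IsGpack k = (Σ (List (List (Fin n))) λ Ps → IsGeodesicPacking Ps × length Ps ≡ k)
            × (∀ Ps → IsGeodesicPacking Ps → length Ps ≤ k)

  IsGeodesicTransversal : Subset n → Set
  IsGeodesicTransversal S = ∀ P → IsMaxGeodesic P → Any (_∈ S) P

  IsGt : ℕ → Set
  IsGt k = (Σ (Subset n) λ S → IsGeodesicTransversal S × ∣ S ∣ ≡ k)
         × (∀ S → IsGeodesicTransversal S → k ≤ ∣ S ∣)

  Connected : Set
  Connected = ∀ u v → Σ (List (Fin n)) λ P → IsWalk P × head P ≡ just u × last P ≡ just v

  IsCycle : List (Fin n) → Set
  IsCycle [] = ⊥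
  IsCycle (x ∷ xs) = Unique (x ∷ xs) × 3 ≤ length (x ∷ xs) × Linked Edge ((x ∷ xs) ++ [ x ])

  Acyclic : Set
  Acyclic = ∀ C → IsCycle C → ⊥

  -- A tree: a nonempty, connected, acyclic graph.
  IsTree : Set
  IsTree = Fin n × Connected × Acyclic

-- In a tree the geodesics are exactly the paths, so the maximal geodesics are the paths that
-- cannot be extended at either end. Root the tree and call the vertex of a path nearest to the
-- root its top. If two paths meet at x, the root path of x runs through both tops, so the path
-- whose top is nearer to the root contains the top of the other. Hence repeatedly choosing a
-- maximal geodesic with the deepest top and discarding every maximal geodesic through that top
-- yields pairwise disjoint maximal geodesics whose tops meet every maximal geodesic. As the
-- members of a packing need distinct vertices of any transversal, this packing and this set of
-- tops are optimal, and they have the same size.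

module Submission where

open import Defs
open import Data.Nat using (ℕ; zero; suc; _+_; _≤_; _<_; z≤n; s≤s)
open import Data.Nat.Properties
  using ( ≤-refl; ≤-trans; ≤-reflexive; ≤-antisym; <⇒≤; <⇒≱; <-irrefl; ≤-pred
        ; m<n⇒m<1+n; m<m+n; +-suc; +-monoʳ-≤; n≤1+n)
open import Data.Bool using (true; false)
import Data.Bool as Bool
open import Data.Fin using (Fin)
open import Data.Fin.Properties using (_≟_; any?)
open import Data.Fin.Subset using (Subset; _∈_; ∣_∣; _∪_; ⁅_⁆; _-_; ⋃)
open import Data.Fin.Subset.Properties
  using (x∈p∪q⁺; x∈⁅x⁆; ∈⊤; ∣⊤∣≡n; ∣⁅x⁆∣≡1; ∣⊥∣≡0; x∈p∧x≢y⇒x∈p-y; x∈p⇒∣p-x∣<∣p∣)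
open import Data.Vec using () renaming ([] to []ᵥ; _∷_ to _∷ᵥ_)
open import Data.List
  using (List; []; _∷_; _++_; [_]; length; reverse; reverseAcc; head; last; map; filter; allFin; cartesianProductWith)
open import Data.List.Properties
  using ( ++-assoc; ++-identityʳ; ++-conicalʳ; length-++; length-++-sucʳ; length-map; length-reverse
        ; unfold-reverse; reverse-++; reverse-involutive; filter-notAll; ≡-dec)
open import Data.List.Relation.Unary.Any using (Any; here; there)
import Data.List.Relation.Unary.Any as Any
import Data.List.Relation.Unary.Any.Properties as Any
open import Data.List.Relation.Unary.All using (All; []; _∷_)
import Data.List.Relation.Unary.All as All
import Data.List.Relation.Unary.All.Properties as All
import Data.List.Relation.Unary.AllPairs as AllPairs
import Data.List.Relation.Unary.AllPairs.Properties as AllPairs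
open import Data.List.Relation.Unary.AllPairs using (AllPairs; []; _∷_)
open import Data.List.Relation.Unary.Linked using (Linked; []; [-]; _∷_; linked?) renaming (tail to Linked-tail)
open import Data.List.Relation.Unary.Unique.Propositional using (Unique)
import Data.List.Relation.Unary.Unique.Propositional.Properties as Unique
open import Data.List.Relation.Binary.Disjoint.Propositional using (Disjoint)
open import Data.List.Relation.Binary.Subset.Propositional using (_⊆_)
open import Data.List.Relation.Binary.Infix.Heterogeneous using (Infix)
import Data.List.Relation.Binary.Infix.Heterogeneous as Infix
open import Data.List.Relation.Binary.Pointwise using (Pointwise-≡⇒≡; ≡⇒Pointwise-≡)
open import Data.List.Relation.Binary.Prefix.Heterogeneous using (Prefix; _++ᵖ_)
import Data.List.Relation.Binary.Prefix.Heterogeneous.Properties as Prefix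
open import Data.List.Membership.Propositional using (find; lose) renaming (_∈_ to _∈ₗ_)
open import Data.List.Membership.Propositional.Properties
  using (∈-∃++; ∈-map⁺; ∈-++⁺ˡ; ∈-++⁺ʳ; ∈-++⁻; ∈-filter⁺; ∈-filter⁻; ∈-allFin; ∈-cartesianProductWith⁺)
open import Data.List.Extrema.Nat
  using (argmin; argmax; argmin-all; argmax-all; f[argmin]≤f[⊤]; f[argmin]≤f[xs]; f[⊥]≤f[argmax]; f[xs]≤f[argmax])
open import Data.Maybe using (just)
open import Data.Maybe.Properties using (just-injective)
open import Data.Product using (Σ; _×_; _,_; proj₁; proj₂; ∃)
open import Data.Sum using (_⊎_; inj₁; inj₂; [_,_]′)
import Data.Sum as Sum
open import Function using (_∘_)
open import Data.Empty using (⊥; ⊥-elim)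
open import Relation.Nullary using (¬_; Dec; yes; no; ¬?)
open import Relation.Nullary.Decidable using (_×-dec_; _⊎-dec_)
open import Relation.Binary using (Rel; Symmetric; DecidableEquality)
open import Relation.Binary.PropositionalEquality using (_≡_; _≢_; refl; sym; trans; cong; subst; subst₂)

module _ {A : Set} where

  lastOr : A → List A → A
  lastOr x []       = x
  lastOr x (y ∷ ys) = lastOr y ys

  last-∷ : ∀ x xs → last (x ∷ xs) ≡ just (lastOr x xs)
  last-∷ x []       = refl
  last-∷ x (y ∷ ys) = last-∷ y ys

  last-∷-cong : ∀ {x} xs {y} ys → lastOr x xs ≡ lastOr y ys → last (x ∷ xs) ≡ last (y ∷ ys)
  last-∷-cong {x} xs {y} ys e = trans (last-∷ x xs) (trans (cong just e) (sym (last-∷ y ys)))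

  last-∷-injective : ∀ {x} xs {y} ys → last (x ∷ xs) ≡ last (y ∷ ys) → lastOr x xs ≡ lastOr y ys
  last-∷-injective {x} xs {y} ys e = just-injective (trans (sym (last-∷ x xs)) (trans e (last-∷ y ys)))

  lastOr-∈ : ∀ x xs → lastOr x xs ∈ₗ x ∷ xs
  lastOr-∈ x []       = here refl
  lastOr-∈ x (y ∷ ys) = there (lastOr-∈ y ys)

  lastOr-++ : ∀ x xs ys → lastOr x (xs ++ ys) ≡ lastOr (lastOr x xs) ys
  lastOr-++ x []       ys = refl
  lastOr-++ x (y ∷ xs) ys = lastOr-++ y xs ys

  length-suffix : ∀ pre {x : A} {post} → length post < length (pre ++ x ∷ post)
  length-suffix []        = ≤-refl
  length-suffix (_ ∷ pre) = m<n⇒m<1+n (length-suffix pre)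

  Unique-++⁻ : ∀ xs {ys : List A} → Unique (xs ++ ys) → Unique xs × Unique ys × Disjoint xs ys
  Unique-++⁻ []       u          = [] , u , λ ()
  Unique-++⁻ (x ∷ xs) (x∉ ∷ u) with Unique-++⁻ xs u
  ... | uxs , uys , disj = All.++⁻ˡ xs x∉ ∷ uxs , uys , λ
    { (here refl , v∈ys) → All.All¬⇒¬Any (All.++⁻ʳ xs x∉) v∈ys
    ; (there v∈xs , v∈ys) → disj (v∈xs , v∈ys) }

  Unique-∷-lastOr : ∀ {u y : A} {ys} → Unique (u ∷ y ∷ ys) → u ≢ lastOr y ys
  Unique-∷-lastOr (u∉ ∷ _) u≡ = All.All¬⇒¬Any u∉ (subst (_∈ₗ _) (sym u≡) (lastOr-∈ _ _))

  Unique-reverse : ∀ {xs : List A} → Unique xs → Unique (reverse xs)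
  Unique-reverse {[]}     u          = u
  Unique-reverse {x ∷ xs} (x∉ ∷ u) rewrite unfold-reverse x xs =
    Unique.++⁺ (Unique-reverse u) ([] ∷ [])
      λ { (x∈ , here refl) → All.All¬⇒¬Any x∉ (Any.reverse⁻ x∈) }

  module _ {ℓ} {R : Rel A ℓ} where

    Linked-++⁻ˡ : ∀ xs {ys} → Linked R (xs ++ ys) → Linked R xs
    Linked-++⁻ˡ []           l       = []
    Linked-++⁻ˡ (x ∷ [])     l       = [-]
    Linked-++⁻ˡ (x ∷ y ∷ xs) (e ∷ l) = e ∷ Linked-++⁻ˡ (y ∷ xs) l

    Linked-++⁻ʳ : ∀ xs {ys} → Linked R (xs ++ ys) → Linked R ys
    Linked-++⁻ʳ []       l = l
    Linked-++⁻ʳ (x ∷ xs) l = Linked-++⁻ʳ xs (Linked-tail l)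

    Linked-join : ∀ {x} xs {ys} → Linked R (x ∷ xs) → Linked R (lastOr x xs ∷ ys) → Linked R (x ∷ xs ++ ys)
    Linked-join []       l       l′ = l′
    Linked-join (y ∷ xs) (e ∷ l) l′ = e ∷ Linked-join xs l l′

    Linked-reverseAcc : Symmetric R → ∀ {x xs acc} → Linked R (x ∷ xs) → Linked R (x ∷ acc) →
                        Linked R (reverseAcc (x ∷ acc) xs)
    Linked-reverseAcc sym-R [-]     l′ = l′
    Linked-reverseAcc sym-R (e ∷ l) l′ = Linked-reverseAcc sym-R l (sym-R e ∷ l′)

    Linked-reverse : Symmetric R → ∀ {xs} → Linked R xs → Linked R (reverse xs)
    Linked-reverse sym-R []        = []
    Linked-reverse sym-R {_ ∷ _} l = Linked-reverseAcc sym-R l [-]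

    WalkWithin : A → A → List A → Set ℓ
    WalkWithin a b xs = ∃ λ ws → Linked R (a ∷ ws) × lastOr a ws ≡ b × (a ∷ ws) ⊆ xs

    walk-++ : ∀ {a b c xs} → WalkWithin a b xs → WalkWithin b c xs → WalkWithin a c xs
    walk-++ {a} (ws₁ , l₁ , refl , sub₁) (ws₂ , l₂ , end₂ , sub₂) =
      ws₁ ++ ws₂ , Linked-join ws₁ l₁ l₂ , trans (lastOr-++ a ws₁ ws₂) end₂ ,
      λ v∈ → [ sub₁ , sub₂ ∘ there ]′ (∈-++⁻ (a ∷ ws₁) v∈)

    walk-from-head : ∀ {x xs b} → Linked R (x ∷ xs) → b ∈ₗ x ∷ xs → WalkWithin x b (x ∷ xs)
    walk-from-head _       (here refl)  = [] , [-] , refl , λ { (here refl) → here refl }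
    walk-from-head (e ∷ l) (there b∈) with walk-from-head l b∈
    ... | ws , l′ , end , sub =
      _ ∷ ws , e ∷ l′ , end , λ { (here v≡x) → here v≡x ; (there v∈) → there (sub v∈) }

    walk-to-head : Symmetric R → ∀ {x xs a} → Linked R (x ∷ xs) → a ∈ₗ x ∷ xs → WalkWithin a x (x ∷ xs)
    walk-to-head sym-R _       (here refl)  = [] , [-] , refl , λ { (here refl) → here refl }
    walk-to-head sym-R {x} (e ∷ l) (there a∈) with walk-to-head sym-R l a∈
    ... | ws , l′ , refl , sub = ws ++ [ x ] , Linked-join ws l′ (sym-R e ∷ [-]) , lastOr-++ _ ws [ x ] ,
      λ v∈ → [ there ∘ sub , (λ { (here refl) → here refl }) ]′ (∈-++⁻ (_ ∷ ws) v∈)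

    walk-within : Symmetric R → ∀ {x xs a b} → Linked R (x ∷ xs) → a ∈ₗ x ∷ xs → b ∈ₗ x ∷ xs →
                  WalkWithin a b (x ∷ xs)
    walk-within sym-R l a∈ b∈ = walk-++ (walk-to-head sym-R l a∈) (walk-from-head l b∈)

module _ {A : Set} (_≟ₐ_ : DecidableEquality A) {ℓ} {R : Rel A ℓ} where

  record Shortcut (x : A) (xs : List A) : Set ℓ where
    field
      ys       : List A
      linked   : Linked R (x ∷ ys)
      unique   : Unique (x ∷ ys)
      same-end : lastOr x ys ≡ lastOr x xs
      within   : (x ∷ ys) ⊆ (x ∷ xs)
      shorter  : ys ≡ xs ⊎ length ys < length xs

    length-ys≤ : length ys ≤ length xs
    length-ys≤ = [ ≤-reflexive ∘ cong length , <⇒≤ ]′ shorter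

    unique-unless-shorter : length xs ≤ length ys → Unique (x ∷ xs)
    unique-unless-shorter xs≤ys with shorter
    ... | inj₁ ys≡xs = subst (λ zs → Unique (x ∷ zs)) ys≡xs unique
    ... | inj₂ ys<xs = ⊥-elim (<⇒≱ ys<xs xs≤ys)

  shortcut : ∀ {x xs} → Linked R (x ∷ xs) → Shortcut x xs
  shortcut {x} {[]} _ = record
    { ys = [] ; linked = [-] ; unique = [] ∷ [] ; same-end = refl ; within = λ v∈ → v∈ ; shorter = inj₁ refl }
  shortcut {x} {y ∷ xs} (e ∷ l) = step (Any.any? (x ≟ₐ_) (y ∷ ys))
    where
    open Shortcut (shortcut l)
    step : Dec (x ∈ₗ y ∷ ys) → Shortcut x (y ∷ xs)
    step (no x∉) = record
      { ys = y ∷ ys ; linked = e ∷ linked ; unique = All.¬Any⇒All¬ _ x∉ ∷ unique ; same-end = same-end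
      ; within = λ { (here v≡x) → here v≡x ; (there v∈) → there (within v∈) }
      ; shorter = Sum.map (cong (y ∷_)) s≤s shorter }
    -- x recurs in the shortened tail: cut out the loop.
    step (yes x∈) with ∈-∃++ x∈
    ... | pre , post , eq = record
      { ys = post
      ; linked = Linked-++⁻ʳ pre (subst (Linked R) eq linked)
      ; unique = proj₁ (proj₂ (Unique-++⁻ pre (subst Unique eq unique)))
      ; same-end = trans (sym (trans (cong (lastOr x) eq) (lastOr-++ x pre (x ∷ post)))) same-end
      ; within = λ { (here v≡x) → here v≡x
                   ; (there v∈) → there (within (subst (_ ∈ₗ_) (sym eq) (∈-++⁺ʳ pre (there v∈)))) }
      ; shorter = inj₂ (s≤s (≤-trans (≤-pred (subst (length post <_) (cong length (sym eq)) (length-suffix pre)))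
                                     length-ys≤)) }

-- Defs' VertexDisjoint Γ, which does not depend on Γ.
Apart : {A : Set} → List A → List A → Set
Apart P Q = ∀ x → x ∈ₗ P → x ∈ₗ Q → ⊥

module _ {n : ℕ} where

  apart⇒length≤∣S∣ : ∀ {S : Subset n} Qs → AllPairs Apart Qs → All (Any (_∈ S)) Qs → length Qs ≤ ∣ S ∣
  apart⇒length≤∣S∣ []       _               _              = z≤n
  apart⇒length≤∣S∣ {S} (Q ∷ Qs) (Q-apart ∷ apart) (hitQ ∷ hits) with find hitQ
  ... | v , v∈Q , v∈S =
    ≤-trans (s≤s (apart⇒length≤∣S∣ Qs apart (All.zipWith missing-v (Q-apart , hits)))) (x∈p⇒∣p-x∣<∣p∣ v∈S)
    where
    missing-v : ∀ {Q′} → Apart Q Q′ × Any (_∈ S) Q′ → Any (_∈ S - v) Q′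
    missing-v (Q#Q′ , hit) with find hit
    ... | w , w∈Q′ , w∈S = lose w∈Q′ (x∈p∧x≢y⇒x∈p-y w∈S λ { refl → Q#Q′ w v∈Q w∈Q′ })

  length-unique≤n : ∀ {xs : List (Fin n)} → Unique xs → length xs ≤ n
  length-unique≤n {xs} u =
    subst₂ _≤_ (length-map [_] xs) (∣⊤∣≡n n)
      (apart⇒length≤∣S∣ (map [_] xs) (AllPairs.map⁺ (AllPairs.map singletons-apart u))
        (All.map⁺ (All.tabulate (λ _ → here ∈⊤))))
    where
    singletons-apart : ∀ {x y : Fin n} → x ≢ y → Apart [ x ] [ y ]
    singletons-apart x≢y _ (here refl) (here refl) = x≢y refl

  ∣p∪q∣≤∣p∣+∣q∣ : ∀ {m} (p q : Subset m) → ∣ p ∪ q ∣ ≤ ∣ p ∣ + ∣ q ∣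
  ∣p∪q∣≤∣p∣+∣q∣ []ᵥ           []ᵥ           = z≤n
  ∣p∪q∣≤∣p∣+∣q∣ (true ∷ᵥ p)  (true ∷ᵥ q)  =
    s≤s (≤-trans (∣p∪q∣≤∣p∣+∣q∣ p q) (+-monoʳ-≤ ∣ p ∣ (n≤1+n _)))
  ∣p∪q∣≤∣p∣+∣q∣ (true ∷ᵥ p)  (false ∷ᵥ q) = s≤s (∣p∪q∣≤∣p∣+∣q∣ p q)
  ∣p∪q∣≤∣p∣+∣q∣ (false ∷ᵥ p) (true ∷ᵥ q)  =
    subst (suc ∣ p ∪ q ∣ ≤_) (sym (+-suc ∣ p ∣ ∣ q ∣)) (s≤s (∣p∪q∣≤∣p∣+∣q∣ p q))
  ∣p∪q∣≤∣p∣+∣q∣ (false ∷ᵥ p) (false ∷ᵥ q) = ∣p∪q∣≤∣p∣+∣q∣ p q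

  ∣⋃⁅xs⁆∣≤length : ∀ (xs : List (Fin n)) → ∣ ⋃ (map ⁅_⁆ xs) ∣ ≤ length xs
  ∣⋃⁅xs⁆∣≤length []       = ≤-reflexive (∣⊥∣≡0 n)
  ∣⋃⁅xs⁆∣≤length (x ∷ xs) =
    ≤-trans (∣p∪q∣≤∣p∣+∣q∣ ⁅ x ⁆ (⋃ (map ⁅_⁆ xs)))
            (subst (λ k → k + _ ≤ suc (length xs)) (sym (∣⁅x⁆∣≡1 x)) (s≤s (∣⋃⁅xs⁆∣≤length xs)))

  ∈⋃⁅xs⁆ : ∀ {x} {xs : List (Fin n)} → x ∈ₗ xs → x ∈ ⋃ (map ⁅_⁆ xs)
  ∈⋃⁅xs⁆ {xs = y ∷ _} (here refl) = x∈p∪q⁺ (inj₁ (x∈⁅x⁆ y))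
  ∈⋃⁅xs⁆              (there x∈)  = x∈p∪q⁺ (inj₂ (∈⋃⁅xs⁆ x∈))

  listsUpTo : ℕ → List (List (Fin n))
  listsUpTo zero    = [ [] ]
  listsUpTo (suc m) = [] ∷ cartesianProductWith _∷_ (allFin n) (listsUpTo m)

  ∈-listsUpTo : ∀ {m} xs → length xs ≤ m → xs ∈ₗ listsUpTo m
  ∈-listsUpTo {zero}  []       _         = here refl
  ∈-listsUpTo {suc m} []       _         = here refl
  ∈-listsUpTo {suc m} (x ∷ xs) (s≤s len≤) =
    there (∈-cartesianProductWith⁺ _∷_ (∈-allFin x) (∈-listsUpTo xs len≤))

module GreedyPacking {A : Set} (_≟ₐ_ : DecidableEquality A)
  (Good : List A → Set) (rep : List A → A) (key : List A → ℕ)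
  (rep-∈ : ∀ {F} → Good F → rep F ∈ₗ F)
  (rep-∈-overlapping : ∀ {F G x} → Good F → Good G → x ∈ₗ F → x ∈ₗ G → key G ≤ key F → rep F ∈ₗ G)
  where

  record Packing (Fs : List (List A)) : Set where
    field
      chosen   : List (List A)
      chosen⊆  : chosen ⊆ Fs
      apart    : AllPairs Apart chosen
      covering : ∀ {F} → F ∈ₗ Fs → Any (λ P → rep P ∈ₗ F) chosen

  greedy : ∀ {k} Fs → length Fs ≤ k → All Good Fs → Packing Fs
  greedy []                   _    _     = record { chosen = [] ; chosen⊆ = λ () ; apart = [] ; covering = λ () }
  greedy {suc k} Fs@(F₀ ∷ Fs₀) len≤ goods = record
    { chosen   = F ∷ chosen
    ; chosen⊆  = λ { (here refl) → F∈ ; (there P∈) → proj₁ (∈-filter⁻ misses-rep? (chosen⊆ P∈)) }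
    ; apart    = All.tabulate F-apart ∷ apart
    ; covering = covering′ }
    where
    F : List A
    F = argmax key F₀ Fs₀

    F∈ : F ∈ₗ Fs
    F∈ = argmax-all key (here refl) (All.tabulate there)

    F-maximal : ∀ {G} → G ∈ₗ Fs → key G ≤ key F
    F-maximal (here refl) = f[⊥]≤f[argmax] {f = key} F₀ Fs₀
    F-maximal (there G∈)  = All.lookup (f[xs]≤f[argmax] {f = key} F₀ Fs₀) G∈

    rep-F∈F : rep F ∈ₗ F
    rep-F∈F = rep-∈ (All.lookup goods F∈)

    misses-rep? : ∀ G → Dec (¬ rep F ∈ₗ G)
    misses-rep? G = ¬? (Any.any? (rep F ≟ₐ_) G)

    rest-shorter : length (filter misses-rep? Fs) < length Fs
    rest-shorter = filter-notAll misses-rep? Fs (lose F∈ λ misses → misses rep-F∈F)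

    open Packing (greedy (filter misses-rep? Fs) (≤-pred (≤-trans rest-shorter len≤))
                   (All.filter⁺ misses-rep? goods))

    F-apart : ∀ {P} → P ∈ₗ chosen → Apart F P
    F-apart P∈ x x∈F x∈P with ∈-filter⁻ misses-rep? (chosen⊆ P∈)
    ... | P∈Fs , misses =
      misses (rep-∈-overlapping (All.lookup goods F∈) (All.lookup goods P∈Fs) x∈F x∈P (F-maximal P∈Fs))

    covering′ : ∀ {G} → G ∈ₗ Fs → Any (λ P → rep P ∈ₗ G) (F ∷ chosen)
    covering′ {G} G∈ with Any.any? (rep F ≟ₐ_) G
    ... | yes hit = here hit
    ... | no miss = there (covering (∈-filter⁺ misses-rep? G∈ miss))

module _ {n : ℕ} (Γ : Graph n) where

  private
    E : Fin n → Fin n → Set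
    E = Edge Γ

  Edge-sym : Symmetric E
  Edge-sym {u} {v} e = trans (Graph.sym Γ v u) e

  IsPath : List (Fin n) → Set
  IsPath P = Linked E P × Unique P

  IsPath-++⁻ : ∀ xs {ys} → IsPath (xs ++ ys) → IsPath xs × IsPath ys
  IsPath-++⁻ xs (l , u) with Unique-++⁻ xs u
  ... | uxs , uys , _ = (Linked-++⁻ˡ xs l , uxs) , (Linked-++⁻ʳ xs l , uys)

  IsPath-tail : ∀ {x xs} → IsPath (x ∷ xs) → IsPath xs
  IsPath-tail = proj₂ ∘ IsPath-++⁻ [ _ ]

  IsPath-reverse : ∀ {P} → IsPath P → IsPath (reverse P)
  IsPath-reverse (l , u) = Linked-reverse Edge-sym l , Unique-reverse u

  geodesic⇒path : ∀ {P} → IsGeodesic Γ P → IsPath P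
  geodesic⇒path {[]}     ((ne , _) , _) = ⊥-elim (ne refl)
  geodesic⇒path {u ∷ xs} ((_ , l) , shortest) =
    l , unique-unless-shorter (≤-pred (shortest (u ∷ ys) ((λ ()) , linked) refl (last-∷-cong ys xs same-end)))
    where open Shortcut (shortcut _≟_ l)

  connected⇒path : Connected Γ → ∀ u w → ∃ λ ys → IsPath (u ∷ ys) × lastOr u ys ≡ w
  connected⇒path conn u w with conn u w
  ... | []     , (ne , _) , _    , _     = ⊥-elim (ne refl)
  ... | x ∷ xs , (_ , l)  , refl , last≡ =
    ys , (linked , unique) , trans same-end (last-∷-injective xs [] last≡)
    where open Shortcut (shortcut _≟_ l)

  Extendable : List (Fin n) → Set
  Extendable P = ∃ λ w → IsPath (w ∷ P) ⊎ IsPath (P ++ [ w ])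

  IsMaximalPath : List (Fin n) → Set
  IsMaximalPath P = P ≢ [] × IsPath P × ¬ Extendable P

  prefixed⇒extendable : ∀ a pre {P} → IsPath (a ∷ pre ++ P) → Extendable P
  prefixed⇒extendable a []         path = a , inj₁ path
  prefixed⇒extendable a (a′ ∷ pre) path = prefixed⇒extendable a′ pre (IsPath-tail path)

  properInfix⇒extendable : ∀ {P Q} → IsPath Q → Infix _≡_ P Q → length P < length Q → Extendable P
  properInfix⇒extendable {P} pathQ P⊑Q with Infix.toView P⊑Q
  ... | Infix.MkView pre P≋ suff with Pointwise-≡⇒≡ P≋
  ... | refl = extend pre suff pathQ
    where
    extend : ∀ pre suff → IsPath (pre ++ P ++ suff) → length P < length (pre ++ P ++ suff) → Extendable P
    extend pre (b ∷ suff) path _ =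
      b , inj₂ (proj₁ (IsPath-++⁻ (P ++ [ b ])
                      (subst IsPath (sym (++-assoc P [ b ] suff)) (proj₂ (IsPath-++⁻ pre path)))))
    extend []        [] _    P<P = ⊥-elim (<-irrefl (sym (cong length (++-identityʳ P))) P<P)
    extend (a ∷ pre) [] path _   = prefixed⇒extendable a pre (subst (λ zs → IsPath (a ∷ pre ++ zs)) (++-identityʳ P) path)

  Extendable-reverse : ∀ {P} → Extendable (reverse P) → Extendable P
  Extendable-reverse {P} (w , inj₁ path) = w , inj₂ (subst IsPath eq (IsPath-reverse path))
    where
    eq : reverse (w ∷ reverse P) ≡ P ++ [ w ]
    eq = trans (unfold-reverse w (reverse P)) (cong (_++ [ w ]) (reverse-involutive P))
  Extendable-reverse {P} (w , inj₂ path) = w , inj₁ (subst IsPath eq (IsPath-reverse path))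
    where
    eq : reverse (reverse P ++ [ w ]) ≡ w ∷ P
    eq = trans (reverse-++ (reverse P) [ w ]) (cong (w ∷_) (reverse-involutive P))

  IsPath? : ∀ P → Dec (IsPath P)
  IsPath? P = linked? (λ u v → Graph.adj Γ u v Bool.≟ true) P ×-dec Unique? P
    where open import Data.List.Relation.Unary.Unique.DecPropositional _≟_ renaming (unique? to Unique?)

  Extendable? : ∀ P → Dec (Extendable P)
  Extendable? P = any? λ w → IsPath? (w ∷ P) ⊎-dec IsPath? (P ++ [ w ])

  IsMaximalPath? : ∀ P → Dec (IsMaximalPath P)
  IsMaximalPath? P = ¬? (≡-dec _≟_ P []) ×-dec IsPath? P ×-dec ¬? (Extendable? P)

  module _ (acyclic : Acyclic Γ) where

    path-no-closing-chord : ∀ {u q p ys} → IsPath (u ∷ q ∷ ys) → p ∈ₗ ys → ¬ E p u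
    path-no-closing-chord {u} {q} {p} path p∈ e with ∈-∃++ p∈
    ... | pre , post , refl = acyclic C (proj₂ C-path , three≤ , Linked-join (q ∷ pre ++ [ p ]) (proj₁ C-path) closing)
      where
      C : List (Fin n)
      C = u ∷ q ∷ pre ++ [ p ]
      path′ : IsPath (C ++ post)
      path′ = subst IsPath (sym (++-assoc (u ∷ q ∷ pre) [ p ] post)) path
      C-path : IsPath C
      C-path = proj₁ (IsPath-++⁻ C path′)
      three≤ : 3 ≤ length C
      three≤ = s≤s (s≤s (subst (1 ≤_) (sym (length-++-sucʳ pre p [])) (s≤s z≤n)))
      closing : Linked E (lastOr u (q ∷ pre ++ [ p ]) ∷ [ u ])
      closing = subst (λ v → Linked E (v ∷ [ u ])) (sym (lastOr-++ q pre [ p ])) (e ∷ [-])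

    paths-unique : ∀ {u} xs ys → IsPath (u ∷ xs) → IsPath (u ∷ ys) → lastOr u xs ≡ lastOr u ys → xs ≡ ys
    paths-unique []       []       _             _             _   = refl
    paths-unique []       (y ∷ ys) _             (_ , uniqueQ) end = ⊥-elim (Unique-∷-lastOr uniqueQ end)
    paths-unique (x ∷ xs) []       (_ , uniqueP) _             end = ⊥-elim (Unique-∷-lastOr uniqueP (sym end))
    paths-unique {u} (p ∷ xs) (q ∷ ys) pathP@(e ∷ _ , (u≢p ∷ u∉xs) ∷ _) pathQ@(lQ , uQ) end with p ≟ q
    ... | yes refl = cong (p ∷_) (paths-unique xs ys (IsPath-tail pathP) (IsPath-tail pathQ) end)
    ... | no p≢q with Any.any? (p ≟_) ys
    ...   | yes p∈ys = ⊥-elim (path-no-closing-chord pathQ p∈ys (Edge-sym e))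
    -- Otherwise p u q ys is a path with the end of p xs, so by induction xs = u q ys, yet u ∉ xs.
    ...   | no p∉ys  = ⊥-elim (All.All¬⇒¬Any u∉xs (subst (u ∈ₗ_) (sym detour) (here refl)))
      where
      detour-path : IsPath (p ∷ u ∷ q ∷ ys)
      detour-path = Edge-sym e ∷ lQ , All.¬Any⇒All¬ _ p∉ ∷ uQ
        where
        p∉ : ¬ p ∈ₗ u ∷ q ∷ ys
        p∉ (here refl)         = u≢p refl
        p∉ (there (here p≡q))  = p≢q p≡q
        p∉ (there (there p∈))  = p∉ys p∈
      detour : xs ≡ u ∷ q ∷ ys
      detour = paths-unique xs (u ∷ q ∷ ys) (IsPath-tail pathP) detour-path end

    path⇒geodesic : ∀ {P} → P ≢ [] → IsPath P → IsGeodesic Γ P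
    path⇒geodesic {[]}     P≢[] _        = ⊥-elim (P≢[] refl)
    path⇒geodesic {u ∷ xs} P≢[] pathP@(l , _) = (P≢[] , l) , shortest
      where
      shortest : ∀ Q → IsWalk Γ Q → head Q ≡ just u → last Q ≡ last (u ∷ xs) → length (u ∷ xs) ≤ length Q
      shortest []       (Q≢[] , _) _    _     = ⊥-elim (Q≢[] refl)
      shortest (u ∷ qs) (_ , lQ)   refl last≡ = s≤s (subst (λ zs → length zs ≤ length qs) ys≡xs length-ys≤)
        where
        open Shortcut (shortcut _≟_ lQ)
        ys≡xs : ys ≡ xs
        ys≡xs = paths-unique ys xs (linked , unique) pathP (trans same-end (last-∷-injective qs xs last≡))

    maxGeodesic⇒maximalPath : ∀ {P} → IsMaxGeodesic Γ P → IsMaximalPath P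
    maxGeodesic⇒maximalPath {P} (geodesic , unextendable) = proj₁ (proj₁ geodesic) , geodesic⇒path geodesic , ¬extendable
      where
      P⊑P : Prefix _≡_ P P
      P⊑P = Prefix.fromPointwise (≡⇒Pointwise-≡ refl)
      ¬extendable : ¬ Extendable P
      ¬extendable (w , inj₁ path) =
        unextendable (w ∷ P , path⇒geodesic (λ ()) path , inj₁ (Infix.there (Infix.here P⊑P)) , ≤-refl)
      ¬extendable (w , inj₂ path) =
        unextendable (P ++ [ w ] , path⇒geodesic ((λ ()) ∘ ++-conicalʳ P [ w ]) path , inj₁ (Infix.here (P⊑P ++ᵖ [ w ])) ,
                      subst (length P <_) (sym (length-++ P)) (m<m+n (length P) (s≤s z≤n)))

    maximalPath⇒maxGeodesic : ∀ {P} → IsMaximalPath P → IsMaxGeodesic Γ P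
    maximalPath⇒maxGeodesic {P} (P≢[] , path , ¬extendable) = path⇒geodesic P≢[] path , λ where
      (Q , geodesic , inj₁ P⊑Q , P<Q) → ¬extendable (properInfix⇒extendable (geodesic⇒path geodesic) P⊑Q P<Q)
      (Q , geodesic , inj₂ P⊑Q , P<Q) → ¬extendable (Extendable-reverse
        (properInfix⇒extendable (geodesic⇒path geodesic) P⊑Q (subst (_< length Q) (sym (length-reverse P)) P<Q)))

  maximalPaths : List (List (Fin n))
  maximalPaths = filter IsMaximalPath? (listsUpTo n)

  ∈-maximalPaths⁺ : ∀ {P} → IsMaximalPath P → P ∈ₗ maximalPaths
  ∈-maximalPaths⁺ {P} maximal@(_ , (_ , uniqueP) , _) =
    ∈-filter⁺ IsMaximalPath? (∈-listsUpTo P (length-unique≤n uniqueP)) maximal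

  ∈-maximalPaths⁻ : ∀ {P} → P ∈ₗ maximalPaths → IsMaximalPath P
  ∈-maximalPaths⁻ = proj₂ ∘ ∈-filter⁻ IsMaximalPath? {xs = listsUpTo n}

  packing≤transversal : ∀ {Qs S} → IsGeodesicPacking Γ Qs → IsGeodesicTransversal Γ S → length Qs ≤ ∣ S ∣
  packing≤transversal {Qs} (maxQs , apart) transversal = apart⇒length≤∣S∣ Qs apart (All.map (transversal _) maxQs)

  module RootedTree (acyclic : Acyclic Γ) (conn : Connected Γ) (root : Fin n) where

    rootPath : Fin n → List (Fin n)
    rootPath v = proj₁ (connected⇒path conn v root)

    rootPath-isPath : ∀ v → IsPath (v ∷ rootPath v)
    rootPath-isPath v = proj₁ (proj₂ (connected⇒path conn v root))

    rootPath-ends : ∀ v → lastOr v (rootPath v) ≡ root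
    rootPath-ends v = proj₂ (proj₂ (connected⇒path conn v root))

    rootPath-unique : ∀ {v ys} → IsPath (v ∷ ys) → lastOr v ys ≡ root → ys ≡ rootPath v
    rootPath-unique {v} {ys} path end =
      paths-unique acyclic ys (rootPath v) path (rootPath-isPath v) (trans end (sym (rootPath-ends v)))

    depth : Fin n → ℕ
    depth v = length (rootPath v)

    depth-< : ∀ {v y} → y ∈ₗ rootPath v → depth y < depth v
    depth-< {v} {y} y∈ with ∈-∃++ y∈
    ... | pre , post , eq = subst₂ _<_ (cong length post≡) (cong length (sym eq)) (length-suffix pre)
      where
      post≡ : post ≡ rootPath y
      post≡ = rootPath-unique (proj₂ (IsPath-++⁻ (v ∷ pre) (subst (λ zs → IsPath (v ∷ zs)) eq (rootPath-isPath v))))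
                (trans (sym (lastOr-++ v pre (y ∷ post))) (trans (cong (lastOr v) (sym eq)) (rootPath-ends v)))

    -- top [] is junk: top is only applied to nonempty paths.
    top : List (Fin n) → Fin n
    top []       = root
    top (x ∷ xs) = argmin depth x xs

    top-∈ : ∀ {x xs} → top (x ∷ xs) ∈ₗ x ∷ xs
    top-∈ = argmin-all depth (here refl) (All.tabulate there)

    top-minimal : ∀ {x xs z} → z ∈ₗ x ∷ xs → depth (top (x ∷ xs)) ≤ depth z
    top-minimal {x} {xs} (here refl) = f[argmin]≤f[⊤] {f = depth} x xs
    top-minimal {x} {xs} (there z∈)  = All.lookup (f[argmin]≤f[xs] {f = depth} x xs) z∈

    rootPath-via-top : ∀ {g gs x} → Linked E (g ∷ gs) → x ∈ₗ g ∷ gs →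
      ∃ λ ys → (x ∷ ys) ⊆ (g ∷ gs) × lastOr x ys ≡ top (g ∷ gs) × rootPath x ≡ ys ++ rootPath (top (g ∷ gs))
    rootPath-via-top {g} {gs} {x} l x∈ with walk-within Edge-sym l x∈ top-∈
    ... | ws , lws , end , sub = ys , sub ∘ within , ends-at-top , sym (rootPath-unique path ends-at-root)
      where
      open Shortcut (shortcut _≟_ lws)
      t : Fin n
      t = top (g ∷ gs)
      ends-at-top : lastOr x ys ≡ t
      ends-at-top = trans same-end end
      -- The segment from x to t lies in g ∷ gs, so no vertex of it is nearer to the root than t.
      path : IsPath (x ∷ ys ++ rootPath t)
      path = Linked-join ys linked (subst (λ v → Linked E (v ∷ rootPath t)) (sym ends-at-top) (proj₁ (rootPath-isPath t))) ,
             Unique.++⁺ unique (proj₂ (IsPath-tail (rootPath-isPath t)))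
               λ (v∈ , v∈′) → <⇒≱ (depth-< v∈′) (top-minimal (sub (within v∈)))
      ends-at-root : lastOr x (ys ++ rootPath t) ≡ root
      ends-at-root = trans (lastOr-++ x ys (rootPath t))
                           (trans (cong (λ v → lastOr v (rootPath t)) ends-at-top) (rootPath-ends t))

    top-∈-rootPath : ∀ {g gs x} → Linked E (g ∷ gs) → x ∈ₗ g ∷ gs → top (g ∷ gs) ∈ₗ x ∷ rootPath x
    top-∈-rootPath {g} {gs} {x} l x∈ =
      let ys , _ , end , eq = rootPath-via-top l x∈ in
      subst (λ zs → top (g ∷ gs) ∈ₗ x ∷ zs) (sym eq) (∈-++⁺ˡ (subst (_∈ₗ x ∷ ys) end (lastOr-∈ x ys)))

    top-∈-overlapping : ∀ {f fs g gs x} → Linked E (f ∷ fs) → Linked E (g ∷ gs) →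
                        x ∈ₗ f ∷ fs → x ∈ₗ g ∷ gs →
                        depth (top (g ∷ gs)) ≤ depth (top (f ∷ fs)) → top (f ∷ fs) ∈ₗ g ∷ gs
    top-∈-overlapping {f} {fs} {g} {gs} {x} lF lG x∈F x∈G tG≤tF =
      let ysG , subG , _ , eqG = rootPath-via-top lG x∈G in
      [ subG , (λ tF∈rootPath-tG → ⊥-elim (<⇒≱ (depth-< tF∈rootPath-tG) tG≤tF)) ]′
        (∈-++⁻ (x ∷ ysG) (subst (λ zs → top (f ∷ fs) ∈ₗ x ∷ zs) eqG (top-∈-rootPath lF x∈F)))

    top-∈-maximal : ∀ {F} → IsMaximalPath F → top F ∈ₗ F
    top-∈-maximal {[]}    (F≢[] , _) = ⊥-elim (F≢[] refl)
    top-∈-maximal {_ ∷ _} _          = top-∈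

    top-∈-overlapping-maximal : ∀ {F G x} → IsMaximalPath F → IsMaximalPath G → x ∈ₗ F → x ∈ₗ G →
                                depth (top G) ≤ depth (top F) → top F ∈ₗ G
    top-∈-overlapping-maximal {_ ∷ _} {_ ∷ _} (_ , (lF , _) , _) (_ , (lG , _) , _) = top-∈-overlapping lF lG
    top-∈-overlapping-maximal {[]}    {_}     (F≢[] , _) _ = ⊥-elim (F≢[] refl)
    top-∈-overlapping-maximal {_ ∷ _} {[]}    _ (G≢[] , _) = ⊥-elim (G≢[] refl)

    open GreedyPacking _≟_ IsMaximalPath top (depth ∘ top) top-∈-maximal top-∈-overlapping-maximal

    topsPacking : Packing maximalPaths
    topsPacking = greedy maximalPaths ≤-refl (All.tabulate ∈-maximalPaths⁻)

    open Packing topsPacking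

    Ps : List (List (Fin n))
    Ps = chosen

    Ps-packing : IsGeodesicPacking Γ Ps
    Ps-packing = All.tabulate (maximalPath⇒maxGeodesic acyclic ∘ ∈-maximalPaths⁻ ∘ chosen⊆) , apart

    tops : Subset n
    tops = ⋃ (map ⁅_⁆ (map top Ps))

    tops-transversal : IsGeodesicTransversal Γ tops
    tops-transversal Q maxQ =
      let P , P∈ , top-P∈Q = find (covering (∈-maximalPaths⁺ (maxGeodesic⇒maximalPath acyclic maxQ))) in
      lose top-P∈Q (∈⋃⁅xs⁆ (∈-map⁺ top P∈))

    ∣tops∣≤ : ∣ tops ∣ ≤ length Ps
    ∣tops∣≤ = subst (∣ tops ∣ ≤_) (length-map top Ps) (∣⋃⁅xs⁆∣≤length (map top Ps))

theorem3p4 : (n : ℕ) (T : Graph n) → IsTree T → Σ ℕ λ k → IsGpack T k × IsGt T k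
theorem3p4 n T (root , conn , acyclic) =
  length Ps ,
  ((Ps , Ps-packing , refl) , λ Qs packing → ≤-trans (packing≤transversal T packing tops-transversal) ∣tops∣≤) ,
  ((tops , tops-transversal , ≤-antisym ∣tops∣≤ (packing≤transversal T Ps-packing tops-transversal)) ,
   λ S transversal → packing≤transversal T Ps-packing transversal)
  where open RootedTree T acyclic conn root
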